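{- Let $n,k,m$ be integers with $1\le k<k+m\le n$, and let $d$ be any integer. Then \[ \left\langle {n \atop d} \right\rangle_k^{k+m} = \left\langle {n-1 \atop d} \right\rangle^m \quad\text{and}\quad \left\langle {n \atop d} \right\rangle_{k+m}^k = \left\langle {n-1 \atop d-1} \right\rangle_m. \]
   Context: $S_n$ is the set of permutations of $\{1,\dots,n\}$. A descent of $\pi\in S_n$ is an index $i$ with $1\le i\le n-1$ and $\pi(i)>\pi(i+1)$; $\mathrm{Des}(\pi)$ is the number of descents. For integers $n,d,k,\ell$: $\left\langle {n \atop d} \right\rangle_k$ is the number of $\pi\in S_n$ with $\mathrm{Des}(\pi)=d$ and $\pi(1)=k$; $\left\langle {n \atop d} \right\rangle^\ell$ is the number of $\pi\in S_n$ with $\mathrm{Des}(\pi)=d$ and $\pi(n)=\ell$; and $\left\langle {n \atop d} \right\rangle_k^\ell$ is the number of $\pi\in S_n$ with $\mathrm{Des}(\pi)=d$, $\pi(1)=k$ and $\pi(n)=\ell$. Each is $0$ if no such permutation exists. -}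

module Defs where

open import Data.Nat using (ℕ; zero; suc; _<ᵇ_; _≡ᵇ_)
open import Data.Integer using (ℤ; +_)
import Data.Integer as ℤ
open import Data.Bool using (Bool; true; false; _∧_; T; if_then_else_)
open import Data.Bool.Properties using (T?)
open import Data.List using (List; []; _∷_; map; concatMap; upTo; filter; length)
open import Relation.Binary.PropositionalEquality using (_≡_)
open import Relation.Nullary.Decidable using (⌊_⌋)
open import Data.Integer.Properties using () renaming (_≟_ to _ℤ≟_)

insertions : {A : Set} → A → List A → List (List A)
insertions x [] = (x ∷ []) ∷ []
insertions x (y ∷ ys) = (x ∷ y ∷ ys) ∷ map (y ∷_) (insertions x ys)

perms : {A : Set} → List A → List (List A)
perms [] = [] ∷ []
perms (x ∷ xs) = concatMap (insertions x) (perms xs)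

-- S n : every permutation π of {1,…,n}, in one-line notation [π(1), …, π(n)],
-- each occurring exactly once
S : ℕ → List (List ℕ)
S n = perms (map suc (upTo n))

des : List ℕ → ℕ
des [] = 0
des (x ∷ []) = 0
des (x ∷ y ∷ r) = (if y <ᵇ x then 1 else 0) Data.Nat.+ des (y ∷ r)

firstIs : ℕ → List ℕ → Bool
firstIs k [] = false
firstIs k (x ∷ _) = x ≡ᵇ k

lastIs : ℕ → List ℕ → Bool
lastIs ℓ [] = false
lastIs ℓ (x ∷ []) = x ≡ᵇ ℓ
lastIs ℓ (x ∷ y ∷ r) = lastIs ℓ (y ∷ r)

countDes : ℕ → ℤ → (List ℕ → Bool) → ℕ
countDes n d p = length (filter (λ π → T? (⌊ + des π ℤ≟ d ⌋ ∧ p π)) (S n))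

-- ⟨n d⟩_k
eulerFirst : ℕ → ℤ → ℕ → ℕ
eulerFirst n d k = countDes n d (firstIs k)

-- ⟨n d⟩^ℓ
eulerLast : ℕ → ℤ → ℕ → ℕ
eulerLast n d ℓ = countDes n d (lastIs ℓ)

-- ⟨n d⟩_k^ℓ
eulerFirstLast : ℕ → ℤ → ℕ → ℕ → ℕ
eulerFirstLast n d k ℓ = countDes n d (λ π → firstIs k π ∧ lastIs ℓ π)

-- Deleting the entry 1 from a permutation whose first and last entries both exceed 1 removes an
-- interior entry, which gives
--   ⟨n+1,d⟩_{k+1}^{ℓ+1} = d ⟨n,d⟩_k^ℓ + (n-d) ⟨n,d-1⟩_k^ℓ.
-- Deleting the entry n from a permutation of {1,…,n} whose last (first) entry is m < n gives the
-- same recurrence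
--   ⟨n,d⟩^m = d ⟨n-1,d⟩^m + (n-d) ⟨n-1,d-1⟩^m,
--   ⟨n,d-1⟩_m = d ⟨n-1,d-1⟩_m + (n-d) ⟨n-1,d-2⟩_m.
-- So both sides of each identity satisfy the same recurrence in k, and for k = 1 the entry 1 is
-- first (last) and its deletion removes no (exactly one) descent.
-- Permutations are generated by inserting the least entry into shorter ones, so only deletion of
-- the minimum can be read off directly; deletion of the maximum follows by induction on n, because
-- inserting a new minimum and inserting a new maximum commute.

module Submission where

open import Defs
open import Data.Nat using (ℕ; zero; suc; _≤_; _<_; _≡ᵇ_; _<ᵇ_; z≤n; s≤s)
open import Data.Integer using (ℤ; +_; _-_; _*_)
open import Data.Product using (_×_; _,_)
open import Relation.Binary.PropositionalEquality
  using (_≡_; refl; sym; trans; cong; cong₂; module ≡-Reasoning)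

module PermutationSums where

  open import Data.Nat as ℕ using ()
  open import Data.Nat.Properties using (suc-injective)
  open import Data.Integer using (_+_)
  open import Data.Integer.Properties
    using (+-identityˡ; +-identityʳ; +-assoc; *-identityˡ; *-identityʳ; *-zeroʳ; *-distribˡ-+)
    renaming (_≟_ to _ℤ≟_)
  open import Data.Integer.Tactic.RingSolver using (solve-∀)
  open import Data.Bool using (Bool; true; false; _∧_; if_then_else_)
  open import Data.Bool.Properties using (T?)
  open import Data.List as List using (List; []; _∷_; _++_; map; concatMap; upTo; filter; length)
  open import Data.List.Properties
    using (map-∘; concatMap-map; concatMap-cong; map-concatMap; map-upTo; length-upTo)
  open import Data.List.Relation.Unary.All as All using (All; []; _∷_)
  open import Data.List.Relation.Unary.All.Properties using (map⁺; concat⁺)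
  open import Relation.Nullary.Decidable using (⌊_⌋; yes; no)
  open import Function using (_∘_)
  open import Data.Empty using (⊥-elim)
  open ≡-Reasoning

  Σ : {A : Set} → (A → ℤ) → List A → ℤ
  Σ f [] = + 0
  Σ f (x ∷ xs) = f x + Σ f xs

  𝟙 : Bool → ℤ
  𝟙 true = + 1
  𝟙 false = + 0

  𝟙-∧ : ∀ a b → 𝟙 (a ∧ b) ≡ 𝟙 a * 𝟙 b
  𝟙-∧ true b = sym (*-identityˡ (𝟙 b))
  𝟙-∧ false b = refl

  module _ {A : Set} where

    Σ-++ : ∀ (f : A → ℤ) xs ys → Σ f (xs ++ ys) ≡ Σ f xs + Σ f ys
    Σ-++ f [] ys = sym (+-identityˡ _)
    Σ-++ f (x ∷ xs) ys = trans (cong (_+_ (f x)) (Σ-++ f xs ys)) (sym (+-assoc (f x) _ _))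

    Σ-concatMap : ∀ {B : Set} (f : A → ℤ) (g : B → List A) xs →
      Σ f (concatMap g xs) ≡ Σ (Σ f ∘ g) xs
    Σ-concatMap f g [] = refl
    Σ-concatMap f g (x ∷ xs) = trans (Σ-++ f (g x) _) (cong (_+_ (Σ f (g x))) (Σ-concatMap f g xs))

    Σ-map : ∀ {B : Set} (f : A → ℤ) (g : B → A) xs → Σ f (map g xs) ≡ Σ (f ∘ g) xs
    Σ-map f g [] = refl
    Σ-map f g (x ∷ xs) = cong (_+_ (f (g x))) (Σ-map f g xs)

    Σ-cong-All : ∀ {f g : A → ℤ} {xs} → All (λ x → f x ≡ g x) xs → Σ f xs ≡ Σ g xs
    Σ-cong-All [] = refl
    Σ-cong-All (e ∷ es) = cong₂ _+_ e (Σ-cong-All es)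

    Σ-cong : ∀ {f g : A → ℤ} → (∀ x → f x ≡ g x) → ∀ xs → Σ f xs ≡ Σ g xs
    Σ-cong f≗g xs = Σ-cong-All {xs = xs} (All.tabulate (λ {x} _ → f≗g x))

    Σ-zero : ∀ {f : A → ℤ} → (∀ x → f x ≡ + 0) → ∀ xs → Σ f xs ≡ + 0
    Σ-zero f≗0 [] = refl
    Σ-zero f≗0 (x ∷ xs) = cong₂ _+_ (f≗0 x) (Σ-zero f≗0 xs)

    Σ-+ : ∀ (f g : A → ℤ) xs → Σ (λ x → f x + g x) xs ≡ Σ f xs + Σ g xs
    Σ-+ f g [] = refl
    Σ-+ f g (x ∷ xs) = trans (cong (_+_ (f x + g x)) (Σ-+ f g xs)) (interchange (f x) (g x) _ _)
      where
      interchange : ∀ a b c d → a + b + (c + d) ≡ a + c + (b + d)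
      interchange = solve-∀

    Σ-* : ∀ c (f : A → ℤ) xs → Σ (λ x → c * f x) xs ≡ c * Σ f xs
    Σ-* c f [] = sym (*-zeroʳ c)
    Σ-* c f (x ∷ xs) = trans (cong (_+_ (c * f x)) (Σ-* c f xs)) (sym (*-distribˡ-+ c (f x) _))

    length-filter : ∀ (P : A → Bool) xs → + length (filter (T? ∘ P) xs) ≡ Σ (𝟙 ∘ P) xs
    length-filter P [] = refl
    length-filter P (x ∷ xs) with P x
    ... | true = cong (_+_ (+ 1)) (length-filter P xs)
    ... | false = trans (length-filter P xs) (sym (+-identityˡ _))

  insertions-map : ∀ {A B : Set} (f : A → B) x ys →
    insertions (f x) (map f ys) ≡ map (map f) (insertions x ys)
  insertions-map f x [] = refl
  insertions-map f x (y ∷ ys) = cong ((f x ∷ f y ∷ map f ys) ∷_) (begin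
      map (f y ∷_) (insertions (f x) (map f ys))   ≡⟨ cong (map (f y ∷_)) (insertions-map f x ys) ⟩
      map (f y ∷_) (map (map f) (insertions x ys)) ≡⟨ sym (map-∘ (insertions x ys)) ⟩
      map (map f ∘ (y ∷_)) (insertions x ys)       ≡⟨ map-∘ (insertions x ys) ⟩
      map (map f) (map (y ∷_) (insertions x ys))   ∎)

  perms-map : ∀ {A B : Set} (f : A → B) xs → perms (map f xs) ≡ map (map f) (perms xs)
  perms-map f [] = refl
  perms-map f (x ∷ xs) = begin
      concatMap (insertions (f x)) (perms (map f xs))
    ≡⟨ cong (concatMap _) (perms-map f xs) ⟩
      concatMap (insertions (f x)) (map (map f) (perms xs))
    ≡⟨ concatMap-map _ (map f) (perms xs) ⟩
      concatMap (insertions (f x) ∘ map f) (perms xs)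
    ≡⟨ concatMap-cong (insertions-map f x) (perms xs) ⟩
      concatMap (map (map f) ∘ insertions x) (perms xs)
    ≡⟨ map-concatMap (map f) (insertions x) (perms xs) ⟨
      map (map f) (concatMap (insertions x) (perms xs))
    ∎

  insertions-length : ∀ {A : Set} (x : A) ys → All (λ r → length r ≡ suc (length ys)) (insertions x ys)
  insertions-length x [] = refl ∷ []
  insertions-length x (y ∷ ys) = refl ∷ map⁺ (All.map (cong suc) (insertions-length x ys))

  perms-length : ∀ {A : Set} (xs : List A) → All (λ p → length p ≡ length xs) (perms xs)
  perms-length [] = refl ∷ []
  perms-length (x ∷ xs) = concat⁺ (map⁺ (All.map lengthen (perms-length xs)))
    where
    lengthen : ∀ {p} → length p ≡ length xs → All (λ r → length r ≡ suc (length xs)) (insertions x p)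
    lengthen e = All.map (λ e′ → trans e′ (cong suc e)) (insertions-length x _)

  S₀ : ℕ → List (List ℕ)
  S₀ n = perms (upTo n)

  S-S₀ : ∀ n → S n ≡ map (map suc) (S₀ n)
  S-S₀ n = perms-map suc (upTo n)

  S₀-suc : ∀ n → S₀ (suc n) ≡ concatMap (insertions 0) (map (map suc) (S₀ n))
  S₀-suc n = cong (concatMap (insertions 0)) (trans (cong perms (sym (map-upTo suc n))) (S-S₀ n))

  S₀-length : ∀ n → All (λ p → length p ≡ n) (S₀ n)
  S₀-length n = All.map (λ e → trans e (length-upTo n)) (perms-length (upTo n))

  des-map-suc : ∀ p → des (map suc p) ≡ des p
  des-map-suc [] = refl
  des-map-suc (x ∷ []) = refl
  des-map-suc (x ∷ y ∷ p) = cong ((if y <ᵇ x then 1 else 0) ℕ.+_) (des-map-suc (y ∷ p))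

  first : List ℕ → ℕ
  first [] = 0
  first (x ∷ _) = x

  lastOf : ℕ → List ℕ → ℕ
  lastOf x [] = x
  lastOf _ (y ∷ ys) = lastOf y ys

  last : List ℕ → ℕ
  last [] = 0
  last (x ∷ xs) = lastOf x xs

  lastOf-map-suc : ∀ x xs → lastOf (suc x) (map suc xs) ≡ suc (lastOf x xs)
  lastOf-map-suc x [] = refl
  lastOf-map-suc x (y ∷ ys) = lastOf-map-suc y ys

  lastIs-map-suc : ∀ l x xs → lastIs (suc l) (map suc (x ∷ xs)) ≡ (lastOf x xs ≡ᵇ l)
  lastIs-map-suc l x [] = refl
  lastIs-map-suc l x (y ∷ ys) = lastIs-map-suc l y ys

  Weight : Set
  Weight = ℕ → ℕ → ℕ → ℤ

  weigh : Weight → List ℕ → ℤ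
  weigh f p = f (des p) (first p) (last p)

  permSum : ℕ → Weight → ℤ
  permSum n f = Σ (weigh f) (S₀ n)

  permSum-cong : ∀ n {f g : Weight} → (∀ x h l → f x h l ≡ g x h l) → permSum n f ≡ permSum n g
  permSum-cong n f≗g = Σ-cong (λ p → f≗g (des p) (first p) (last p)) (S₀ n)

  -- A new least entry 0 in front keeps the x descents, at the end it adds one, and in the interior it
  -- keeps x in each of the x gaps at a descent and adds one in each of the n - x gaps at an ascent.
  insertMin : ℕ → Weight → Weight
  insertMin n f x h l =
    f x 0 (suc l) + (f (suc x) (suc h) 0 + (+ x * f x (suc h) (suc l) + (+ n - + x) * f (suc x) (suc h) (suc l)))

  Σ-insertions-0-after : ∀ (g : ℕ → ℕ → ℤ) a q →
    let x = des (a ∷ q) ; l = lastOf a q in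
    Σ (λ r → g (des (suc a ∷ r)) (lastOf (suc a) r)) (insertions 0 (map suc q))
    ≡ g (suc x) 0 + (+ x * g x (suc l) + (+ length q - + x) * g (suc x) (suc l))
  Σ-insertions-0-after g a [] = refl
  Σ-insertions-0-after g a (b ∷ q) = begin
      g (suc (des (suc b ∷ map suc q))) (lastOf (suc b) (map suc q))
        + Σ (λ r → g (des (suc a ∷ r)) (lastOf (suc a) r)) (map (suc b ∷_) rs)
    ≡⟨ cong₂ _+_ (cong₂ g (cong suc (des-map-suc (b ∷ q))) (lastOf-map-suc b q))
                 (Σ-map _ (List._∷_ (suc b)) rs) ⟩
      g (suc y) (suc l) + Σ (λ r → g (c ℕ.+ des (suc b ∷ r)) (lastOf (suc b) r)) rs
    ≡⟨ cong (_+_ (g (suc y) (suc l))) (Σ-insertions-0-after (λ x → g (c ℕ.+ x)) b q) ⟩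
      g (suc y) (suc l) + rhs (λ x → g (c ℕ.+ x)) (length q) y
    ≡⟨ between-a-and-b (b <ᵇ a) ⟩
      rhs g (suc (length q)) (c ℕ.+ y)
    ∎
    where
    c = if b <ᵇ a then 1 else 0
    y = des (b ∷ q)
    l = lastOf b q
    rs = insertions 0 (map suc q)
    rhs : (ℕ → ℕ → ℤ) → ℕ → ℕ → ℤ
    rhs g′ len x = g′ (suc x) 0 + (+ x * g′ x (suc l) + (+ len - + x) * g′ (suc x) (suc l))
    -- the gap between a and b gains a descent exactly when a < b
    between-a-and-b : ∀ β → let c = if β then 1 else 0 in
      g (suc y) (suc l) + rhs (λ x → g (c ℕ.+ x)) (length q) y ≡ rhs g (suc (length q)) (c ℕ.+ y)
    between-a-and-b true =
      ring (g (suc y) (suc l)) (g (suc (suc y)) 0) (g (suc (suc y)) (suc l)) (+ y) (+ length q)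
      where
      ring : ∀ A B C Y L →
        A + (B + (Y * A + (L - Y) * C)) ≡ B + ((+ 1 + Y) * A + ((+ 1 + L) - (+ 1 + Y)) * C)
      ring = solve-∀
    between-a-and-b false =
      ring (g (suc y) (suc l)) (g (suc y) 0) (g y (suc l)) (+ y) (+ length q)
      where
      ring : ∀ A B D Y L → A + (B + (Y * D + (L - Y) * A)) ≡ B + (Y * D + ((+ 1 + L) - Y) * A)
      ring = solve-∀

  Σ-insertions-0 : ∀ f a q →
    Σ (weigh f) (insertions 0 (map suc (a ∷ q))) ≡ weigh (insertMin (length q) f) (a ∷ q)
  Σ-insertions-0 f a q = cong₂ _+_
    (cong₂ (λ x l → f x 0 l) (des-map-suc (a ∷ q)) (lastOf-map-suc a q))
    (trans (Σ-map (weigh f) (List._∷_ (suc a)) (insertions 0 (map suc q)))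
           (Σ-insertions-0-after (λ x l → f x (suc a) l) a q))

  permSum-insertMin : ∀ n f → permSum (suc (suc n)) f ≡ permSum (suc n) (insertMin n f)
  permSum-insertMin n f = begin
      Σ (weigh f) (S₀ (suc (suc n)))
    ≡⟨ cong (Σ (weigh f)) (S₀-suc (suc n)) ⟩
      Σ (weigh f) (concatMap (insertions 0) (map (map suc) (S₀ (suc n))))
    ≡⟨ Σ-concatMap (weigh f) (insertions 0) (map (map suc) (S₀ (suc n))) ⟩
      Σ (Σ (weigh f) ∘ insertions 0) (map (map suc) (S₀ (suc n)))
    ≡⟨ Σ-map _ (map suc) (S₀ (suc n)) ⟩
      Σ (λ p → Σ (weigh f) (insertions 0 (map suc p))) (S₀ (suc n))
    ≡⟨ Σ-cong-All (All.map (λ {p} → insert {p}) (S₀-length (suc n))) ⟩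
      Σ (weigh (insertMin n f)) (S₀ (suc n))
    ∎
    where
    insert : ∀ {p} → length p ≡ suc n →
      Σ (weigh f) (insertions 0 (map suc p)) ≡ weigh (insertMin n f) p
    insert {a ∷ q} e =
      trans (Σ-insertions-0 f a q) (cong (λ m → weigh (insertMin m f) (a ∷ q)) (suc-injective e))

  -- A new greatest entry suc n adds a descent in front and none at the end; interior gaps as above.
  insertMax : ℕ → Weight → Weight
  insertMax n f x h l =
    f x h (suc n) + (f (suc x) (suc n) l + (+ x * f x h l + (+ n - + x) * f (suc x) h l))

  insertMin-insertMax : ∀ n f x h l →
    insertMax n (insertMin (suc n) f) x h l ≡ insertMin n (insertMax (suc n) f) x h l
  insertMin-insertMax n f x h l = ring (+ n) (+ x)
    (f x 0 (suc (suc n))) (f (suc x) (suc h) 0) (f x (suc h) (suc (suc n))) (f (suc x) (suc h) (suc (suc n)))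
    (f (suc x) 0 (suc l)) (f (suc (suc x)) (suc (suc n)) 0) (f (suc x) (suc (suc n)) (suc l))
    (f (suc (suc x)) (suc (suc n)) (suc l)) (f x 0 (suc l)) (f x (suc h) (suc l)) (f (suc x) (suc h) (suc l))
    (f (suc (suc x)) (suc h) 0) (f (suc (suc x)) (suc h) (suc l))
    where
    ring : ∀ N X a₁ a₂ a₃ a₄ a₅ a₆ a₇ a₈ a₉ a₁₀ a₁₁ a₁₂ a₁₃ →
      a₁ + (a₂ + (X * a₃ + ((+ 1 + N) - X) * a₄))
      + (a₅ + (a₆ + ((+ 1 + X) * a₇ + ((+ 1 + N) - (+ 1 + X)) * a₈))
      + (X * (a₉ + (a₂ + (X * a₁₀ + ((+ 1 + N) - X) * a₁₁)))
      + (N - X) * (a₅ + (a₁₂ + ((+ 1 + X) * a₁₁ + ((+ 1 + N) - (+ 1 + X)) * a₁₃)))))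
      ≡ a₁ + (a₇ + (X * a₉ + ((+ 1 + N) - X) * a₅))
      + (a₄ + (a₆ + ((+ 1 + X) * a₂ + ((+ 1 + N) - (+ 1 + X)) * a₁₂))
      + (X * (a₃ + (a₇ + (X * a₁₀ + ((+ 1 + N) - X) * a₁₁)))
      + (N - X) * (a₄ + (a₈ + ((+ 1 + X) * a₁₁ + ((+ 1 + N) - (+ 1 + X)) * a₁₃)))))
    ring = solve-∀

  permSum-insertMax : ∀ n f → permSum (suc (suc n)) f ≡ permSum (suc n) (insertMax n f)
  -- on the single permutation [0] both insertion weights reduce to f 0 0 1 + (f 1 1 0 + + 0)
  permSum-insertMax zero f = permSum-insertMin zero f
  permSum-insertMax (suc n) f = begin
      permSum (suc (suc (suc n))) f
    ≡⟨ permSum-insertMin (suc n) f ⟩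
      permSum (suc (suc n)) (insertMin (suc n) f)
    ≡⟨ permSum-insertMax n (insertMin (suc n) f) ⟩
      permSum (suc n) (insertMax n (insertMin (suc n) f))
    ≡⟨ permSum-cong (suc n) (insertMin-insertMax n f) ⟩
      permSum (suc n) (insertMin n (insertMax (suc n) f))
    ≡⟨ permSum-insertMin n (insertMax (suc n) f) ⟨
      permSum (suc (suc n)) (insertMax (suc n) f)
    ∎

  δ : ℕ → ℤ → ℤ
  δ x d = 𝟙 ⌊ + x ℤ≟ d ⌋

  δ-suc : ∀ x d → δ (suc x) d ≡ δ x (d - + 1)
  δ-suc x d with + suc x ℤ≟ d | + x ℤ≟ d - + 1
  ... | yes _ | yes _ = refl
  ... | no _ | no _ = refl
  ... | yes refl | no x≢d-1 = ⊥-elim (x≢d-1 refl)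
  ... | no 1+x≢d | yes x≡d-1 = ⊥-elim (1+x≢d (trans (cong (_+_ (+ 1)) x≡d-1) (ring d)))
    where
    ring : ∀ d → + 1 + (d - + 1) ≡ d
    ring = solve-∀

  δ-support : ∀ (c : ℤ → ℤ) x d a → c (+ x) * (δ x d * a) ≡ c d * (δ x d * a)
  δ-support c x d a with + x ℤ≟ d
  ... | yes x≡d = cong (λ t → c t * (+ 1 * a)) x≡d
  ... | no _ = trans (*-zeroʳ (c (+ x))) (sym (*-zeroʳ (c d)))

  withDes : ℤ → (ℕ → ℕ → ℤ) → Weight
  withDes d φ x h l = δ x d * φ h l

  count : ℕ → ℤ → (ℕ → ℕ → ℤ) → ℤ
  count n d φ = permSum n (withDes d φ)

  count-cong : ∀ n d {φ ψ : ℕ → ℕ → ℤ} → (∀ h l → φ h l ≡ ψ h l) → count n d φ ≡ count n d ψ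
  count-cong n d φ≗ψ = permSum-cong n (λ x h l → cong (δ x d *_) (φ≗ψ h l))

  count-zero : ∀ n d {φ : ℕ → ℕ → ℤ} → (∀ h l → φ h l ≡ + 0) → count n d φ ≡ + 0
  count-zero n d φ≗0 =
    Σ-zero (λ p → trans (cong (δ (des p) d *_) (φ≗0 (first p) (last p))) (*-zeroʳ (δ (des p) d))) (S₀ n)

  δ-expand : ∀ n x d (a b c : ℤ) →
    δ x d * a + (δ (suc x) d * b + (+ x * (δ x d * c) + (+ n - + x) * (δ (suc x) d * c)))
    ≡ δ x d * a + (δ x (d - + 1) * b + (d * (δ x d * c) + (+ suc n - d) * (δ x (d - + 1) * c)))
  δ-expand n x d a b c rewrite δ-suc x d =
    cong (λ t → δ x d * a + (δ x (d - + 1) * b + t)) (cong₂ _+_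
      (δ-support (λ t → t) x d c)
      (trans (δ-support (+ n -_) x (d - + 1) c) (cong (_* (δ x (d - + 1) * c)) (ring (+ n) d))))
    where
    ring : ∀ N d → N - (d - + 1) ≡ (+ 1 + N) - d
    ring = solve-∀

  count-combination : ∀ n d e (φ ψ χ : ℕ → ℕ → ℤ) α β →
    permSum n (λ x h l →
      withDes d φ x h l + (withDes e ψ x h l + (α * withDes d χ x h l + β * withDes e χ x h l)))
    ≡ count n d φ + (count n e ψ + (α * count n d χ + β * count n e χ))
  count-combination n d e φ ψ χ α β =
    trans (Σ-+ (weigh (withDes d φ)) _ (S₀ n)) (cong (_+_ (count n d φ))
    (trans (Σ-+ (weigh (withDes e ψ)) _ (S₀ n)) (cong (_+_ (count n e ψ))
    (trans (Σ-+ _ _ (S₀ n))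
           (cong₂ _+_ (Σ-* α (weigh (withDes d χ)) (S₀ n)) (Σ-* β (weigh (withDes e χ)) (S₀ n)))))))

  interiorStep : ℕ → ℤ → ℤ → ℤ → ℤ
  interiorStep n d X Y = d * X + (+ n - d) * Y

  interiorStep-zero : ∀ n d {X Y} → X ≡ + 0 → Y ≡ + 0 → interiorStep n d X Y ≡ + 0
  interiorStep-zero n d refl refl = cong₂ _+_ (*-zeroʳ d) (*-zeroʳ (+ n - d))

  count-insertMin : ∀ n d φ →
    count (suc (suc n)) d φ
    ≡ count (suc n) d (λ _ l → φ 0 (suc l))
      + (count (suc n) (d - + 1) (λ h _ → φ (suc h) 0)
      + interiorStep (suc n) d (count (suc n) d (λ h l → φ (suc h) (suc l)))
                               (count (suc n) (d - + 1) (λ h l → φ (suc h) (suc l))))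
  count-insertMin n d φ =
    trans (permSum-insertMin n (withDes d φ))
    (trans (permSum-cong (suc n) λ x h l → δ-expand n x d (φ 0 (suc l)) (φ (suc h) 0) (φ (suc h) (suc l)))
           (count-combination (suc n) d (d - + 1) (λ _ l → φ 0 (suc l)) (λ h _ → φ (suc h) 0)
                              (λ h l → φ (suc h) (suc l)) d (+ suc n - d)))

  count-insertMax : ∀ n d φ →
    count (suc (suc n)) d φ
    ≡ count (suc n) d (λ h _ → φ h (suc n))
      + (count (suc n) (d - + 1) (λ _ l → φ (suc n) l)
      + interiorStep (suc n) d (count (suc n) d φ) (count (suc n) (d - + 1) φ))
  count-insertMax n d φ =
    trans (permSum-insertMax n (withDes d φ))
    (trans (permSum-cong (suc n) (λ x h l → δ-expand n x d (φ h (suc n)) (φ (suc n) l) (φ h l)))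
           (count-combination (suc n) d (d - + 1) (λ h _ → φ h (suc n)) (λ _ l → φ (suc n) l)
                              φ d (+ suc n - d)))

  atFirst : ℕ → ℕ → ℕ → ℤ
  atFirst k h _ = 𝟙 (h ≡ᵇ k)

  atLast : ℕ → ℕ → ℕ → ℤ
  atLast l _ t = 𝟙 (t ≡ᵇ l)

  atFirstLast : ℕ → ℕ → ℕ → ℕ → ℤ
  atFirstLast k l h t = 𝟙 (h ≡ᵇ k) * 𝟙 (t ≡ᵇ l)

  count-atFirstLast-suc-suc : ∀ n d k l →
    count (suc (suc n)) d (atFirstLast (suc k) (suc l))
    ≡ interiorStep (suc n) d (count (suc n) d (atFirstLast k l)) (count (suc n) (d - + 1) (atFirstLast k l))
  count-atFirstLast-suc-suc n d k l =
    trans (count-insertMin n d (atFirstLast (suc k) (suc l)))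
    (trans (cong₂ (λ a b → a + (b + step)) (count-zero (suc n) d (λ _ _ → refl))
                                           (count-zero (suc n) (d - + 1) (λ h _ → *-zeroʳ (𝟙 (h ≡ᵇ k)))))
           (trans (+-identityˡ _) (+-identityˡ step)))
    where
    step = interiorStep (suc n) d (count (suc n) d (atFirstLast k l)) (count (suc n) (d - + 1) (atFirstLast k l))

  count-atFirstLast-zero-suc : ∀ n d l →
    count (suc (suc n)) d (atFirstLast 0 (suc l)) ≡ count (suc n) d (atLast l)
  count-atFirstLast-zero-suc n d l =
    trans (count-insertMin n d (atFirstLast 0 (suc l)))
    (trans (cong₂ _+_ (count-cong (suc n) d (λ _ t → *-identityˡ (𝟙 (t ≡ᵇ l))))
                      (cong₂ _+_ (vanish (d - + 1)) (interiorStep-zero (suc n) d (vanish d) (vanish (d - + 1)))))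
           (+-identityʳ _))
    where
    vanish : ∀ e → count (suc n) e (λ _ _ → + 0) ≡ + 0
    vanish e = count-zero (suc n) e (λ _ _ → refl)

  count-atFirstLast-suc-zero : ∀ n d k →
    count (suc (suc n)) d (atFirstLast (suc k) 0) ≡ count (suc n) (d - + 1) (atFirst k)
  count-atFirstLast-suc-zero n d k =
    trans (count-insertMin n d (atFirstLast (suc k) 0))
    (trans (cong₂ _+_ (count-zero (suc n) d (λ _ _ → refl))
                      (cong₂ _+_ (count-cong (suc n) (d - + 1) (λ h _ → *-identityʳ (𝟙 (h ≡ᵇ k))))
                                 (interiorStep-zero (suc n) d (vanish d) (vanish (d - + 1)))))
           (trans (+-identityˡ _) (+-identityʳ _)))
    where
    vanish : ∀ e → count (suc n) e (λ h _ → 𝟙 (h ≡ᵇ k) * + 0) ≡ + 0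
    vanish e = count-zero (suc n) e (λ h _ → *-zeroʳ (𝟙 (h ≡ᵇ k)))

  suc-≡ᵇ-false : ∀ {m n} → m ≤ n → (suc n ≡ᵇ m) ≡ false
  suc-≡ᵇ-false z≤n = refl
  suc-≡ᵇ-false (s≤s m≤n) = suc-≡ᵇ-false m≤n

  count-atLast-insertMax : ∀ {m n} → m ≤ n → ∀ d →
    count (suc (suc n)) d (atLast m)
    ≡ interiorStep (suc (suc n)) d (count (suc n) d (atLast m)) (count (suc n) (d - + 1) (atLast m))
  count-atLast-insertMax {m} {n} m≤n d = begin
      count (suc (suc n)) d (atLast m)
    ≡⟨ count-insertMax n d (atLast m) ⟩
      count (suc n) d (λ _ _ → 𝟙 (suc n ≡ᵇ m)) + (Y + interiorStep (suc n) d X Y)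
    ≡⟨ cong (_+ (Y + interiorStep (suc n) d X Y))
            (count-zero (suc n) d (λ _ _ → cong 𝟙 (suc-≡ᵇ-false m≤n))) ⟩
      + 0 + (Y + interiorStep (suc n) d X Y)
    ≡⟨ ring (+ n) d X Y ⟩
      interiorStep (suc (suc n)) d X Y
    ∎
    where
    X = count (suc n) d (atLast m)
    Y = count (suc n) (d - + 1) (atLast m)
    ring : ∀ N d X Y →
      + 0 + (Y + (d * X + ((+ 1 + N) - d) * Y)) ≡ d * X + ((+ 1 + (+ 1 + N)) - d) * Y
    ring = solve-∀

  count-atFirst-insertMax : ∀ {m n} → m ≤ n → ∀ d →
    count (suc (suc n)) (d - + 1) (atFirst m)
    ≡ interiorStep (suc (suc n)) d (count (suc n) (d - + 1) (atFirst m))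
                                   (count (suc n) (d - + 1 - + 1) (atFirst m))
  count-atFirst-insertMax {m} {n} m≤n d = begin
      count (suc (suc n)) (d - + 1) (atFirst m)
    ≡⟨ count-insertMax n (d - + 1) (atFirst m) ⟩
      X + (count (suc n) (d - + 1 - + 1) (λ _ _ → 𝟙 (suc n ≡ᵇ m)) + interiorStep (suc n) (d - + 1) X Y)
    ≡⟨ cong (λ z → X + (z + interiorStep (suc n) (d - + 1) X Y))
            (count-zero (suc n) (d - + 1 - + 1) (λ _ _ → cong 𝟙 (suc-≡ᵇ-false m≤n))) ⟩
      X + (+ 0 + interiorStep (suc n) (d - + 1) X Y)
    ≡⟨ ring (+ n) d X Y ⟩
      interiorStep (suc (suc n)) d X Y
    ∎
    where
    X = count (suc n) (d - + 1) (atFirst m)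
    Y = count (suc n) (d - + 1 - + 1) (atFirst m)
    ring : ∀ N d X Y →
      X + (+ 0 + ((d - + 1) * X + ((+ 1 + N) - (d - + 1)) * Y)) ≡ d * X + ((+ 1 + (+ 1 + N)) - d) * Y
    ring = solve-∀

  countDes-count : ∀ n d (P : List ℕ → Bool) (φ : ℕ → ℕ → ℤ) →
    (∀ a q → 𝟙 (P (map suc (a ∷ q))) ≡ φ a (lastOf a q)) →
    + countDes (suc n) d P ≡ count (suc n) d φ
  countDes-count n d P φ P≗φ = begin
      + countDes (suc n) d P
    ≡⟨ length-filter (λ π → ⌊ + des π ℤ≟ d ⌋ ∧ P π) (S (suc n)) ⟩
      Σ (λ π → 𝟙 (⌊ + des π ℤ≟ d ⌋ ∧ P π)) (S (suc n))
    ≡⟨ cong (Σ _) (S-S₀ (suc n)) ⟩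
      Σ (λ π → 𝟙 (⌊ + des π ℤ≟ d ⌋ ∧ P π)) (map (map suc) (S₀ (suc n)))
    ≡⟨ Σ-map _ (map suc) (S₀ (suc n)) ⟩
      Σ (λ p → 𝟙 (⌊ + des (map suc p) ℤ≟ d ⌋ ∧ P (map suc p))) (S₀ (suc n))
    ≡⟨ Σ-cong-All (All.map (λ {p} → unshift {p}) (S₀-length (suc n))) ⟩
      count (suc n) d φ
    ∎
    where
    unshift : ∀ {p} → length p ≡ suc n →
      𝟙 (⌊ + des (map suc p) ℤ≟ d ⌋ ∧ P (map suc p)) ≡ withDes d φ (des p) (first p) (last p)
    unshift {a ∷ q} _ =
      trans (𝟙-∧ ⌊ + des (map suc (a ∷ q)) ℤ≟ d ⌋ (P (map suc (a ∷ q))))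
            (cong₂ _*_ (cong (λ x → δ x d) (des-map-suc (a ∷ q))) (P≗φ a q))

  eulerFirstLast-count : ∀ n d k l →
    + eulerFirstLast (suc n) d (suc k) (suc l) ≡ count (suc n) d (atFirstLast k l)
  eulerFirstLast-count n d k l = countDes-count n d _ (atFirstLast k l)
    (λ a q → trans (𝟙-∧ (a ≡ᵇ k) _) (cong (λ b → 𝟙 (a ≡ᵇ k) * 𝟙 b) (lastIs-map-suc l a q)))

  eulerLast-count : ∀ n d l → + eulerLast (suc n) d (suc l) ≡ count (suc n) d (atLast l)
  eulerLast-count n d l = countDes-count n d _ (atLast l) (λ a q → cong 𝟙 (lastIs-map-suc l a q))

  eulerFirst-count : ∀ n d k → + eulerFirst (suc n) d (suc k) ≡ count (suc n) d (atFirst k)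
  eulerFirst-count n d k = countDes-count n d _ (atFirst k) (λ _ _ → refl)

open PermutationSums
open import Data.Nat using (_+_)
open import Data.Nat.Properties using (m+n≤o⇒n≤o; <-irrefl; +-identityʳ)
open import Data.Integer.Properties using (+-injective)
open import Data.Empty using (⊥-elim)
open ≡-Reasoning

count-first<last : ∀ k {N} d m → k + suc m ≤ N →
  count (suc N) d (atFirstLast k (k + suc m)) ≡ count N d (atLast m)
count-first<last zero {suc n} d m _ = count-atFirstLast-zero-suc n d m
count-first<last (suc k) {suc n} d m (s≤s k+m<n) with m+n≤o⇒n≤o k k+m<n
... | s≤s m≤n′ = begin
    count (suc (suc n)) d (atFirstLast (suc k) (suc k + suc m))
  ≡⟨ count-atFirstLast-suc-suc n d k (k + suc m) ⟩
    interiorStep (suc n) d (count (suc n) d φ) (count (suc n) (d - + 1) φ)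
  ≡⟨ cong₂ (interiorStep (suc n) d) (count-first<last k d m k+m<n) (count-first<last k (d - + 1) m k+m<n) ⟩
    interiorStep (suc n) d (count n d (atLast m)) (count n (d - + 1) (atLast m))
  ≡⟨ count-atLast-insertMax m≤n′ d ⟨
    count (suc n) d (atLast m)
  ∎
  where
  φ = atFirstLast k (k + suc m)

count-first>last : ∀ k {N} d m → k + suc m ≤ N →
  count (suc N) d (atFirstLast (k + suc m) k) ≡ count N (d - + 1) (atFirst m)
count-first>last zero {suc n} d m _ = count-atFirstLast-suc-zero n d m
count-first>last (suc k) {suc n} d m (s≤s k+m<n) with m+n≤o⇒n≤o k k+m<n
... | s≤s m≤n′ = begin
    count (suc (suc n)) d (atFirstLast (suc k + suc m) (suc k))
  ≡⟨ count-atFirstLast-suc-suc n d (k + suc m) k ⟩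
    interiorStep (suc n) d (count (suc n) d φ) (count (suc n) (d - + 1) φ)
  ≡⟨ cong₂ (interiorStep (suc n) d) (count-first>last k d m k+m<n) (count-first>last k (d - + 1) m k+m<n) ⟩
    interiorStep (suc n) d (count n (d - + 1) (atFirst m)) (count n (d - + 1 - + 1) (atFirst m))
  ≡⟨ count-atFirst-insertMax m≤n′ d ⟨
    count (suc n) (d - + 1) (atFirst m)
  ∎
  where
  φ = atFirstLast (k + suc m) k

theorem10 : (n k m : ℕ) → (d : ℤ) → 1 ≤ k → k < k + m → k + m ≤ n →
    (eulerFirstLast n d k (k + m) ≡ eulerLast (n Data.Nat.∸ 1) d m)
    × (eulerFirstLast n d (k + m) k ≡ eulerFirst (n Data.Nat.∸ 1) (d - + 1) m)
theorem10 n (suc k) zero d _ k<k+0 _ = ⊥-elim (<-irrefl (sym (+-identityʳ (suc k))) k<k+0)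
theorem10 (suc n) (suc k) (suc m) d _ _ (s≤s k+m<n) with m+n≤o⇒n≤o k k+m<n
... | s≤s {n = n′} _ =
    +-injective (begin
      + eulerFirstLast (suc n) d (suc k) (suc k + suc m) ≡⟨ eulerFirstLast-count n d k (k + suc m) ⟩
      count (suc n) d (atFirstLast k (k + suc m))         ≡⟨ count-first<last k d m k+m<n ⟩
      count n d (atLast m)                                ≡⟨ eulerLast-count n′ d m ⟨
      + eulerLast n d (suc m)                             ∎)
  , +-injective (begin
      + eulerFirstLast (suc n) d (suc k + suc m) (suc k) ≡⟨ eulerFirstLast-count n d (k + suc m) k ⟩
      count (suc n) d (atFirstLast (k + suc m) k)         ≡⟨ count-first>last k d m k+m<n ⟩
      count n (d - + 1) (atFirst m)                       ≡⟨ eulerFirst-count n′ (d - + 1) m ⟨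
      + eulerFirst n (d - + 1) (suc m)                    ∎)
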